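{- Let $G(V,E)$ be a unit disk graph, and let $VC(G)$ be the set produced by Heuristic VCover (described below) on $G$. Then $|VC(G)| \le 1.5\,|VC^*(G)|$, where $VC^*(G)$ is a minimum vertex cover of $G$. Heuristic VCover: (1) Set $V_1=\emptyset$, $V'=V$. (2) While the induced subgraph $G(V')$ contains a triangle, pick $X\subseteq V'$ with $G(X)$ a triangle and set $V_1 = V_1\cup X$, $V' = V'\setminus X$. (3) Obtain disjoint sets $P,Q\subseteq V'$ by applying the Nemhauser–Trotter decomposition to $G(V')$; these satisfy: (a) some minimum vertex cover of $G(V')$ contains $P$; (b) for every vertex cover $D$ of $G(Q)$, $D\cup P$ is a vertex cover of $G(V')$; (c) every minimum vertex cover of $G(V')$ has size at least $|P|+|Q|/2$. (4) Properly color $G(Q)$ with 4 colors and let $S$ be a color class of largest cardinality. (5) Output $VC(G) = V_1 \cup P \cup (Q\setminus S)$.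
   Context: A graph is a unit disk graph if its vertices can be put in one-to-one correspondence with circles of radius 1 in the plane so that two vertices are adjacent if and only if the corresponding closed disks intersect (tangent circles intersect). A vertex cover of $G$ is a set of vertices containing at least one endpoint of every edge. For $U\subseteq V$, $G(U)$ denotes the subgraph induced on $U$. (The graph $G(Q)$ in step (4) is a triangle-free unit disk graph, hence 4-colorable.) -}

module Defs where

open import Level using (0ℓ)
open import Data.Nat using (ℕ)
import Data.Nat as ℕ
open import Data.Fin using (Fin; _≟_)
open import Data.Fin.Subset using (Subset; _∈_; _⊆_; _∪_; _∩_; _─_; ∣_∣; ⊥; ⊤)
open import Data.Vec using (tabulate)
open import Data.Product using (_×_; Σ-syntax)
open import Data.Sum using (_⊎_)
open import Data.Empty using () renaming (⊥ to Empty)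
open import Relation.Nullary using (¬_; does)
open import Relation.Binary.PropositionalEquality using (_≡_; _≢_)
open import Relation.Binary.Core using (Rel)
open import Relation.Binary.Structures using (IsTotalOrder)
open import Algebra.Bundles using (CommutativeRing)

-- Coordinates: an ordered commutative ring (ℝ is one instance).

record OrderedCommRing : Set₁ where
  field
    commRing : CommutativeRing 0ℓ 0ℓ
  open CommutativeRing commRing public
  field
    _≤ᴿ_         : Rel Carrier 0ℓ
    isTotalOrder : IsTotalOrder _≈_ _≤ᴿ_
    +-mono       : ∀ {a b} c → a ≤ᴿ b → (a + c) ≤ᴿ (b + c)
    *-nonneg     : ∀ {a b} → 0# ≤ᴿ a → 0# ≤ᴿ b → 0# ≤ᴿ (a * b)

record Graph (n : ℕ) : Set₁ where
  field
    Adj   : Fin n → Fin n → Set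
    sym   : ∀ {i j} → Adj i j → Adj j i
    irrefl : ∀ {i} → ¬ Adj i i

open Graph public

-- G is a unit disk graph (over the ordered ring R): there are centres
-- (x i , y i) of radius-1 circles such that i ~ j iff i ≠ j and the
-- closed unit disks intersect, i.e. squared centre distance ≤ 4.
module _ (R : OrderedCommRing) where
  open OrderedCommRing R

  four : Carrier
  four = 1# + 1# + 1# + 1#

  sqDist : Carrier → Carrier → Carrier → Carrier → Carrier
  sqDist x₁ y₁ x₂ y₂ = ((x₁ - x₂) * (x₁ - x₂)) + ((y₁ - y₂) * (y₁ - y₂))

  IsUnitDiskGraph : ∀ {n} → Graph n → Set
  IsUnitDiskGraph {n} G =
    Σ[ x ∈ (Fin n → Carrier) ] Σ[ y ∈ (Fin n → Carrier) ]
      (∀ i j → (Adj G i j → (i ≢ j × (sqDist (x i) (y i) (x j) (y j) ≤ᴿ four)))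
             × ((i ≢ j × (sqDist (x i) (y i) (x j) (y j) ≤ᴿ four)) → Adj G i j))

module _ {n : ℕ} (G : Graph n) where

  IsVertexCoverOf : Subset n → Subset n → Set
  IsVertexCoverOf U C =
    C ⊆ U × (∀ i j → i ∈ U → j ∈ U → Adj G i j → (i ∈ C ⊎ j ∈ C))

  IsMinVertexCoverOf : Subset n → Subset n → Set
  IsMinVertexCoverOf U C =
    IsVertexCoverOf U C × (∀ C′ → IsVertexCoverOf U C′ → ∣ C ∣ ℕ.≤ ∣ C′ ∣)

  IsTriangle : Subset n → Set
  IsTriangle X = ∣ X ∣ ≡ 3 × (∀ i j → i ∈ X → j ∈ X → i ≢ j → Adj G i j)

  TriangleFree : Subset n → Set
  TriangleFree U = ∀ X → X ⊆ U → ¬ IsTriangle X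

  -- Step (2) of Heuristic VCover: TriangleLoop V₁ V′ V₁ᶠ V′ᶠ means that the
  -- while-loop, started in state (V₁ , V′), can terminate in state (V₁ᶠ , V′ᶠ).
  data TriangleLoop : Subset n → Subset n → Subset n → Subset n → Set where
    stop : ∀ {V₁ V′} → TriangleFree V′ → TriangleLoop V₁ V′ V₁ V′
    pick : ∀ {V₁ V′ V₁ᶠ V′ᶠ} X → X ⊆ V′ → IsTriangle X →
           TriangleLoop (V₁ ∪ X) (V′ ─ X) V₁ᶠ V′ᶠ →
           TriangleLoop V₁ V′ V₁ᶠ V′ᶠ

  -- Step (3): P, Q is a Nemhauser–Trotter decomposition of G(V′)
  -- satisfying properties (a), (b), (c).  (c) |P| + |Q|/2 ≤ |M| is written
  -- 2|P| + |Q| ≤ 2|M|.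
  IsNTDecomposition : Subset n → Subset n → Subset n → Set
  IsNTDecomposition V′ P Q =
    P ⊆ V′ × Q ⊆ V′ × (∀ i → i ∈ P → i ∈ Q → Empty)
    × (Σ[ M ∈ Subset n ] (IsMinVertexCoverOf V′ M × P ⊆ M))
    × (∀ D → IsVertexCoverOf Q D → IsVertexCoverOf V′ (D ∪ P))
    × (∀ M → IsMinVertexCoverOf V′ M → (2 ℕ.* ∣ P ∣) ℕ.+ ∣ Q ∣ ℕ.≤ 2 ℕ.* ∣ M ∣)

  IsProper4Coloring : Subset n → (Fin n → Fin 4) → Set
  IsProper4Coloring Q c =
    ∀ i j → i ∈ Q → j ∈ Q → Adj G i j → c i ≢ c j

  colorClass : Subset n → (Fin n → Fin 4) → Fin 4 → Subset n
  colorClass Q c k = Q ∩ tabulate (λ i → does (c i ≟ k))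

  IsLargestColorClass : Subset n → (Fin n → Fin 4) → Subset n → Set
  IsLargestColorClass Q c S =
    Σ[ k ∈ Fin 4 ] (S ≡ colorClass Q c k
                    × (∀ k′ → ∣ colorClass Q c k′ ∣ ℕ.≤ ∣ S ∣))

  IsVCoverOutput : Subset n → Set
  IsVCoverOutput VC =
    Σ[ V₁ ∈ Subset n ] Σ[ V′ ∈ Subset n ] Σ[ P ∈ Subset n ] Σ[ Q ∈ Subset n ]
    Σ[ c ∈ (Fin n → Fin 4) ] Σ[ S ∈ Subset n ]
      TriangleLoop ⊥ ⊤ V₁ V′
      × IsNTDecomposition V′ P Q
      × IsProper4Coloring Q c
      × IsLargestColorClass Q c S
      × VC ≡ V₁ ∪ P ∪ (Q ─ S)

-- Every triangle removed in step (2) contains at least two vertices of any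
-- vertex cover C, so 2|V₁| + 3|C ∩ V′| ≤ 3|C| when the loop ends.  On the
-- remaining graph, dropping a largest of four colour classes gives
-- |Q ─ S| ≤ 3|Q|/4, and property (c) of the Nemhauser–Trotter decomposition
-- yields |P| + |Q ─ S| ≤ (3/2)(|P| + |Q|/2) ≤ (3/2)|C ∩ V′|.  Adding up,
-- 2|VC| ≤ 2|V₁| + 3|C ∩ V′| ≤ 3|C|.
module Submission where

open import Defs
open import Data.Nat using (ℕ; _*_; _≤_)
open import Data.Fin.Subset using (Subset; ∣_∣; ⊤)

open import Data.Nat using (zero; suc; _+_; z≤n; s≤s; _≤?_)
open import Data.Nat.Properties
  using (≤-refl; ≤-trans; ≤-reflexive; +-suc; +-comm; n≤1+n;
         +-mono-≤; +-monoˡ-≤; +-monoʳ-≤; *-monoˡ-≤; *-monoʳ-≤;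
         +-cancelʳ-≤; *-cancelˡ-≤; ≰⇒>; ≤-pred; *-distribˡ-+; module ≤-Reasoning)
open import Data.Nat.Tactic.RingSolver using (solve-∀)
open import Data.Bool using (true; false)
open import Data.Vec using ([]; _∷_; here; there)
open import Data.Vec.Properties using (lookup⇒[]=; lookup∘tabulate)
open import Data.Fin using (Fin; zero; suc; _≟_)
open import Data.Fin.Properties using () renaming (suc-injective to Fin-suc-injective)
open import Data.Fin.Subset using (_∈_; _∉_; _⊆_; _∪_; _∩_; _─_; Nonempty; ⋃)
open import Data.Fin.Subset.Properties
  using (x∈p∩q⁺; x∈p∩q⁻; p∩q⊆p; p∩q⊆q; x∈p∧x∉q⇒x∈p─q; x∈p∪q⁺;
         p⊆q⇒∣p∣≤∣q∣; ∣⊥∣≡0; ∣p∩q∣≤∣p∣; ∈⊤)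
open import Data.List as List using (List; length)
open import Data.List.Relation.Unary.All as All using (All)
open import Data.List.Relation.Unary.All.Properties using (tabulate⁺)
open import Data.List.Relation.Unary.Any as Any using ()
open import Data.List.Membership.Propositional using () renaming (_∈_ to _∈ₗ_)
open import Data.List.Membership.Propositional.Properties using (∈-tabulate⁺)
open import Data.Product using (_×_; _,_; Σ-syntax; proj₂)
open import Data.Sum as Sum using (inj₁; inj₂)
open import Relation.Binary.PropositionalEquality as ≡ using (_≡_; _≢_; refl; trans; cong; subst)
open import Relation.Nullary using (yes; no)
open import Relation.Nullary.Decidable using (dec-true)
open import Relation.Nullary.Negation using (contradiction)

∣p∪q∣≤∣p∣+∣q∣ : ∀ {n} (p q : Subset n) → ∣ p ∪ q ∣ ≤ ∣ p ∣ + ∣ q ∣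
∣p∪q∣≤∣p∣+∣q∣ [] [] = z≤n
∣p∪q∣≤∣p∣+∣q∣ (true ∷ p) (true ∷ q) =
  s≤s (≤-trans (∣p∪q∣≤∣p∣+∣q∣ p q) (+-monoʳ-≤ ∣ p ∣ (n≤1+n ∣ q ∣)))
∣p∪q∣≤∣p∣+∣q∣ (true ∷ p) (false ∷ q) = s≤s (∣p∪q∣≤∣p∣+∣q∣ p q)
∣p∪q∣≤∣p∣+∣q∣ (false ∷ p) (true ∷ q) =
  ≤-trans (s≤s (∣p∪q∣≤∣p∣+∣q∣ p q)) (≤-reflexive (≡.sym (+-suc ∣ p ∣ ∣ q ∣)))
∣p∪q∣≤∣p∣+∣q∣ (false ∷ p) (false ∷ q) = ∣p∪q∣≤∣p∣+∣q∣ p q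

∣p∩q∣+∣p─q∣≡∣p∣ : ∀ {n} (p q : Subset n) → ∣ p ∩ q ∣ + ∣ p ─ q ∣ ≡ ∣ p ∣
∣p∩q∣+∣p─q∣≡∣p∣ [] [] = refl
∣p∩q∣+∣p─q∣≡∣p∣ (true ∷ p) (true ∷ q) = cong suc (∣p∩q∣+∣p─q∣≡∣p∣ p q)
∣p∩q∣+∣p─q∣≡∣p∣ (true ∷ p) (false ∷ q) = trans (+-suc _ _) (cong suc (∣p∩q∣+∣p─q∣≡∣p∣ p q))
∣p∩q∣+∣p─q∣≡∣p∣ (false ∷ p) (true ∷ q) = ∣p∩q∣+∣p─q∣≡∣p∣ p q
∣p∩q∣+∣p─q∣≡∣p∣ (false ∷ p) (false ∷ q) = ∣p∩q∣+∣p─q∣≡∣p∣ p q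

x∈p─q⁻ : ∀ {n} {x : Fin n} (p q : Subset n) → x ∈ p ─ q → x ∈ p × x ∉ q
x∈p─q⁻ (true ∷ p) (false ∷ q) here = here , λ ()
x∈p─q⁻ {x = zero} (true ∷ p) (true ∷ q) ()
x∈p─q⁻ {x = zero} (false ∷ p) (true ∷ q) ()
x∈p─q⁻ {x = zero} (false ∷ p) (false ∷ q) ()
x∈p─q⁻ (_ ∷ p) (_ ∷ q) (there x∈p─q) with x∈p─q⁻ p q x∈p─q
... | x∈p , x∉q = there x∈p , λ { (there x∈q) → x∉q x∈q }

∣q─p∣+∣p∣≤∣q∣ : ∀ {n} {p q : Subset n} → p ⊆ q → ∣ q ─ p ∣ + ∣ p ∣ ≤ ∣ q ∣
∣q─p∣+∣p∣≤∣q∣ {p = p} {q} p⊆q = begin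
  ∣ q ─ p ∣ + ∣ p ∣      ≤⟨ +-monoʳ-≤ ∣ q ─ p ∣ (p⊆q⇒∣p∣≤∣q∣ (λ x∈p → x∈p∩q⁺ (p⊆q x∈p , x∈p))) ⟩
  ∣ q ─ p ∣ + ∣ q ∩ p ∣  ≡⟨ +-comm ∣ q ─ p ∣ ∣ q ∩ p ∣ ⟩
  ∣ q ∩ p ∣ + ∣ q ─ p ∣  ≡⟨ ∣p∩q∣+∣p─q∣≡∣p∣ q p ⟩
  ∣ q ∣                  ∎
  where open ≤-Reasoning

∣p∩[q─r]∣+∣r∩p∣≤∣p∩q∣ : ∀ {n} (p : Subset n) {q r : Subset n} → r ⊆ q →
                        ∣ p ∩ (q ─ r) ∣ + ∣ r ∩ p ∣ ≤ ∣ p ∩ q ∣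
∣p∩[q─r]∣+∣r∩p∣≤∣p∩q∣ p {q} {r} r⊆q = begin
  ∣ p ∩ (q ─ r) ∣ + ∣ r ∩ p ∣        ≤⟨ +-mono-≤ (p⊆q⇒∣p∣≤∣q∣ outside-r) (p⊆q⇒∣p∣≤∣q∣ inside-r) ⟩
  ∣ p ∩ q ─ r ∣ + ∣ (p ∩ q) ∩ r ∣    ≡⟨ +-comm ∣ p ∩ q ─ r ∣ ∣ (p ∩ q) ∩ r ∣ ⟩
  ∣ (p ∩ q) ∩ r ∣ + ∣ p ∩ q ─ r ∣    ≡⟨ ∣p∩q∣+∣p─q∣≡∣p∣ (p ∩ q) r ⟩
  ∣ p ∩ q ∣                          ∎
  where
  open ≤-Reasoning
  outside-r : p ∩ (q ─ r) ⊆ p ∩ q ─ r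
  outside-r x∈ with x∈p∩q⁻ p (q ─ r) x∈
  ... | x∈p , x∈q─r with x∈p─q⁻ q r x∈q─r
  ... | x∈q , x∉r = x∈p∧x∉q⇒x∈p─q (x∈p∩q⁺ (x∈p , x∈q)) x∉r
  inside-r : r ∩ p ⊆ (p ∩ q) ∩ r
  inside-r x∈ with x∈p∩q⁻ r p x∈
  ... | x∈r , x∈p = x∈p∩q⁺ (x∈p∩q⁺ (x∈p , r⊆q x∈r) , x∈r)

1≤∣p∣⇒nonempty : ∀ {n} (p : Subset n) → 1 ≤ ∣ p ∣ → Nonempty p
1≤∣p∣⇒nonempty (true ∷ p) _ = zero , here
1≤∣p∣⇒nonempty (false ∷ p) 1≤∣p∣ with 1≤∣p∣⇒nonempty p 1≤∣p∣
... | x , x∈p = suc x , there x∈p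

2≤∣p∣⇒distinct-members : ∀ {n} (p : Subset n) → 2 ≤ ∣ p ∣ →
                         Σ[ x ∈ Fin n ] Σ[ y ∈ Fin n ] (x ∈ p × y ∈ p × x ≢ y)
2≤∣p∣⇒distinct-members (true ∷ p) (s≤s 1≤∣p∣) with 1≤∣p∣⇒nonempty p 1≤∣p∣
... | y , y∈p = zero , suc y , here , there y∈p , λ ()
2≤∣p∣⇒distinct-members (false ∷ p) 2≤∣p∣ with 2≤∣p∣⇒distinct-members p 2≤∣p∣
... | x , y , x∈p , y∈p , x≢y =
  suc x , suc y , there x∈p , there y∈p , λ sx≡sy → x≢y (Fin-suc-injective sx≡sy)

x∈⋃⁺ : ∀ {n} {x : Fin n} {p : Subset n} {ps : List (Subset n)} → x ∈ p → p ∈ₗ ps → x ∈ ⋃ ps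
x∈⋃⁺ x∈p (Any.here refl) = x∈p∪q⁺ (inj₁ x∈p)
x∈⋃⁺ x∈p (Any.there p∈ps) = x∈p∪q⁺ (inj₂ (x∈⋃⁺ x∈p p∈ps))

∣⋃ps∣≤length*bound : ∀ {n} {b : ℕ} (ps : List (Subset n)) →
                     All (λ p → ∣ p ∣ ≤ b) ps → ∣ ⋃ ps ∣ ≤ length ps * b
∣⋃ps∣≤length*bound {n} List.[] All.[] = ≤-reflexive (∣⊥∣≡0 n)
∣⋃ps∣≤length*bound (p List.∷ ps) (∣p∣≤b All.∷ bounded) =
  ≤-trans (∣p∪q∣≤∣p∣+∣q∣ p (⋃ ps)) (+-mono-≤ ∣p∣≤b (∣⋃ps∣≤length*bound ps bounded))

a+b≡3⇒a≤1⇒2≤b : ∀ {a b} → a + b ≡ 3 → a ≤ 1 → 2 ≤ b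
a+b≡3⇒a≤1⇒2≤b {zero} refl _ = s≤s (s≤s z≤n)
a+b≡3⇒a≤1⇒2≤b {suc zero} refl _ = s≤s (s≤s z≤n)
a+b≡3⇒a≤1⇒2≤b {suc (suc a)} _ (s≤s ())

r+s≤q⇒q≤4s⇒4r≤3q : ∀ {q r s} → r + s ≤ q → q ≤ 4 * s → 4 * r ≤ 3 * q
r+s≤q⇒q≤4s⇒4r≤3q {q} {r} {s} r+s≤q q≤4s = +-cancelʳ-≤ (4 * s) (4 * r) (3 * q) (begin
  4 * r + 4 * s  ≡⟨ *-distribˡ-+ 4 r s ⟨
  4 * (r + s)    ≤⟨ *-monoʳ-≤ 4 r+s≤q ⟩
  4 * q          ≡⟨ +-comm q (3 * q) ⟩
  3 * q + q      ≤⟨ +-monoʳ-≤ (3 * q) q≤4s ⟩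
  3 * q + 4 * s  ∎)
  where open ≤-Reasoning

4r≤3q⇒2p+q≤2m⇒2[p+r]≤3m : ∀ {m p q r} → 4 * r ≤ 3 * q → 2 * p + q ≤ 2 * m → 2 * (p + r) ≤ 3 * m
4r≤3q⇒2p+q≤2m⇒2[p+r]≤3m {m} {p} {q} {r} 4r≤3q 2p+q≤2m = *-cancelˡ-≤ 2 (begin
  2 * (2 * (p + r))  ≡⟨ expand p r ⟩
  4 * p + 4 * r      ≤⟨ +-mono-≤ (*-monoˡ-≤ p {4} {6} (s≤s (s≤s (s≤s (s≤s z≤n))))) 4r≤3q ⟩
  6 * p + 3 * q      ≡⟨ factor p q ⟩
  3 * (2 * p + q)    ≤⟨ *-monoʳ-≤ 3 2p+q≤2m ⟩
  3 * (2 * m)        ≡⟨ swap m ⟩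
  2 * (3 * m)        ∎)
  where
  open ≤-Reasoning
  expand : ∀ p r → 2 * (2 * (p + r)) ≡ 4 * p + 4 * r
  expand = solve-∀
  factor : ∀ p q → 6 * p + 3 * q ≡ 3 * (2 * p + q)
  factor = solve-∀
  swap : ∀ m → 3 * (2 * m) ≡ 2 * (3 * m)
  swap = solve-∀

module _ {n : ℕ} (G : Graph n) where

  cover-∩ : ∀ {U V C} → IsVertexCoverOf G U C → V ⊆ U → IsVertexCoverOf G V (C ∩ V)
  cover-∩ {V = V} {C = C} (_ , covers) V⊆U = p∩q⊆q C V , λ i j i∈V j∈V i~j →
    Sum.map (λ i∈C → x∈p∩q⁺ (i∈C , i∈V)) (λ j∈C → x∈p∩q⁺ (j∈C , j∈V))
            (covers i j (V⊆U i∈V) (V⊆U j∈V) i~j)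

  cover-meets-triangle : ∀ {U C X} → IsVertexCoverOf G U C → X ⊆ U → IsTriangle G X →
                         2 ≤ ∣ X ∩ C ∣
  cover-meets-triangle {C = C} {X} (_ , covers) X⊆U (∣X∣≡3 , complete) with 2 ≤? ∣ X ∩ C ∣
  ... | yes 2≤∣X∩C∣ = 2≤∣X∩C∣
  ... | no 2≰∣X∩C∣ with 2≤∣p∣⇒distinct-members (X ─ C)
         (a+b≡3⇒a≤1⇒2≤b (trans (∣p∩q∣+∣p─q∣≡∣p∣ X C) ∣X∣≡3) (≤-pred (≰⇒> 2≰∣X∩C∣)))
  ... | i , j , i∈X─C , j∈X─C , i≢j with x∈p─q⁻ X C i∈X─C | x∈p─q⁻ X C j∈X─C
  ... | i∈X , i∉C | j∈X , j∉C with covers i j (X⊆U i∈X) (X⊆U j∈X) (complete i j i∈X j∈X i≢j)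
  ... | inj₁ i∈C = contradiction i∈C i∉C
  ... | inj₂ j∈C = contradiction j∈C j∉C

  triangle-step : ∀ {C V₁ V′ X} → IsVertexCoverOf G ⊤ C → X ⊆ V′ → IsTriangle G X →
                  2 * ∣ V₁ ∪ X ∣ + 3 * ∣ C ∩ (V′ ─ X) ∣ ≤ 2 * ∣ V₁ ∣ + 3 * ∣ C ∩ V′ ∣
  triangle-step {C} {V₁} {V′} {X} C-cover X⊆V′ X-triangle@(∣X∣≡3 , _) = begin
    2 * ∣ V₁ ∪ X ∣ + 3 * e          ≤⟨ +-monoˡ-≤ (3 * e) (*-monoʳ-≤ 2 ∣V₁∪X∣≤∣V₁∣+3) ⟩
    2 * (∣ V₁ ∣ + 3) + 3 * e        ≡⟨ regroup ∣ V₁ ∣ e ⟩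
    2 * ∣ V₁ ∣ + 3 * (e + 2)        ≤⟨ +-monoʳ-≤ (2 * ∣ V₁ ∣) (*-monoʳ-≤ 3 e+2≤∣C∩V′∣) ⟩
    2 * ∣ V₁ ∣ + 3 * ∣ C ∩ V′ ∣     ∎
    where
    open ≤-Reasoning
    e : ℕ
    e = ∣ C ∩ (V′ ─ X) ∣
    ∣V₁∪X∣≤∣V₁∣+3 : ∣ V₁ ∪ X ∣ ≤ ∣ V₁ ∣ + 3
    ∣V₁∪X∣≤∣V₁∣+3 = subst (λ k → ∣ V₁ ∪ X ∣ ≤ ∣ V₁ ∣ + k) ∣X∣≡3 (∣p∪q∣≤∣p∣+∣q∣ V₁ X)
    e+2≤∣C∩V′∣ : e + 2 ≤ ∣ C ∩ V′ ∣
    e+2≤∣C∩V′∣ = ≤-trans (+-monoʳ-≤ e (cover-meets-triangle C-cover (λ _ → ∈⊤) X-triangle))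
                         (∣p∩[q─r]∣+∣r∩p∣≤∣p∩q∣ C X⊆V′)
    regroup : ∀ v e → 2 * (v + 3) + 3 * e ≡ 2 * v + 3 * (e + 2)
    regroup = solve-∀

  triangle-loop-invariant : ∀ {C V₁ V′ V₁ᶠ V′ᶠ} → IsVertexCoverOf G ⊤ C →
                            TriangleLoop G V₁ V′ V₁ᶠ V′ᶠ →
                            2 * ∣ V₁ᶠ ∣ + 3 * ∣ C ∩ V′ᶠ ∣ ≤ 2 * ∣ V₁ ∣ + 3 * ∣ C ∩ V′ ∣
  triangle-loop-invariant C-cover (stop _) = ≤-refl
  triangle-loop-invariant {V₁ = V₁} C-cover (pick X X⊆V′ X-triangle loop) =
    ≤-trans (triangle-loop-invariant C-cover loop) (triangle-step {V₁ = V₁} C-cover X⊆V′ X-triangle)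

  ∈-colorClass : ∀ {Q c i} → i ∈ Q → i ∈ colorClass G Q c (c i)
  ∈-colorClass {c = c} {i} i∈Q =
    x∈p∩q⁺ (i∈Q , lookup⇒[]= i _ (trans (lookup∘tabulate _ i) (dec-true (c i ≟ c i) refl)))

  ∣Q∣≤4∣S∣ : ∀ {Q c S} → IsLargestColorClass G Q c S → ∣ Q ∣ ≤ 4 * ∣ S ∣
  ∣Q∣≤4∣S∣ {Q} {c} (_ , _ , largest) = ≤-trans
    (p⊆q⇒∣p∣≤∣q∣ (λ {i} i∈Q → x∈⋃⁺ (∈-colorClass {c = c} i∈Q) (∈-tabulate⁺ {f = class} (c i))))
    (∣⋃ps∣≤length*bound (List.tabulate class) (tabulate⁺ {f = class} largest))
    where
    class : Fin 4 → Subset n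
    class = colorClass G Q c

  4∣Q─S∣≤3∣Q∣ : ∀ {Q c S} → IsLargestColorClass G Q c S → 4 * ∣ Q ─ S ∣ ≤ 3 * ∣ Q ∣
  4∣Q─S∣≤3∣Q∣ {Q} {c} {S} S-largest@(_ , S≡class , _) =
    r+s≤q⇒q≤4s⇒4r≤3q {∣ Q ∣} {∣ Q ─ S ∣} {∣ S ∣} (∣q─p∣+∣p∣≤∣q∣ S⊆Q) (∣Q∣≤4∣S∣ {c = c} S-largest)
    where
    S⊆Q : S ⊆ Q
    S⊆Q x∈S = p∩q⊆p Q _ (subst (_ ∈_) S≡class x∈S)

  vcover-output-bound : ∀ {VC C} → IsVCoverOutput G VC → IsVertexCoverOf G ⊤ C →
                        2 * ∣ VC ∣ ≤ 3 * ∣ C ∣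
  vcover-output-bound {C = C}
    (V₁ , V′ , P , Q , c , S , loop , (_ , _ , _ , (M , M-min , _) , _ , nt-bound) , _ , S-largest , refl)
    C-cover = begin
      2 * ∣ V₁ ∪ P ∪ (Q ─ S) ∣                   ≤⟨ *-monoʳ-≤ 2 ∣VC∣≤ ⟩
      2 * (∣ V₁ ∣ + (∣ P ∣ + ∣ Q ─ S ∣))          ≡⟨ *-distribˡ-+ 2 ∣ V₁ ∣ _ ⟩
      2 * ∣ V₁ ∣ + 2 * (∣ P ∣ + ∣ Q ─ S ∣)        ≤⟨ +-monoʳ-≤ (2 * ∣ V₁ ∣) remainder ⟩
      2 * ∣ V₁ ∣ + 3 * ∣ C ∩ V′ ∣                ≤⟨ triangles ⟩
      3 * ∣ C ∣                                  ∎
    where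
    open ≤-Reasoning
    ∣VC∣≤ : ∣ V₁ ∪ P ∪ (Q ─ S) ∣ ≤ ∣ V₁ ∣ + (∣ P ∣ + ∣ Q ─ S ∣)
    ∣VC∣≤ = ≤-trans (∣p∪q∣≤∣p∣+∣q∣ V₁ _) (+-monoʳ-≤ ∣ V₁ ∣ (∣p∪q∣≤∣p∣+∣q∣ P _))
    remainder : 2 * (∣ P ∣ + ∣ Q ─ S ∣) ≤ 3 * ∣ C ∩ V′ ∣
    remainder = ≤-trans (4r≤3q⇒2p+q≤2m⇒2[p+r]≤3m {∣ M ∣} {∣ P ∣}
                           (4∣Q─S∣≤3∣Q∣ {c = c} S-largest) (nt-bound M M-min))
                        (*-monoʳ-≤ 3 (proj₂ M-min (C ∩ V′) (cover-∩ C-cover (λ _ → ∈⊤))))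
    triangles : 2 * ∣ V₁ ∣ + 3 * ∣ C ∩ V′ ∣ ≤ 3 * ∣ C ∣
    triangles = ≤-trans (triangle-loop-invariant C-cover loop)
                        (≤-trans (≤-reflexive (cong (λ k → 2 * k + 3 * ∣ C ∩ ⊤ ∣) (∣⊥∣≡0 n)))
                                 (*-monoʳ-≤ 3 (∣p∩q∣≤∣p∣ C ⊤)))

-- The unit disk hypothesis only guarantees that the 4-colouring of step (4)
-- exists; the bound holds for every output and every vertex cover.
theorem4p3 : (R : OrderedCommRing) → (n : ℕ) → (G : Graph n) →
    IsUnitDiskGraph R G →
    (VC : Subset n) → IsVCoverOutput G VC →
    (VCstar : Subset n) → IsMinVertexCoverOf G ⊤ VCstar →
    2 * ∣ VC ∣ ≤ 3 * ∣ VCstar ∣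
theorem4p3 _ _ G _ _ output _ (cover , _) = vcover-output-bound G output cover
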